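{- Let $G$ be a $3$-edge-connected multigraph with DFS tree $\mathcal{T}$. For every tree edge $e$, among the tree edges $f\ge_{\mathcal{T}} e$ such that every back edge leaping over $e$ has its tail in $\mathcal{T}_f$, there is a unique deepest one; denote it $\mathrm{DeepestDnCut}(e)$. Moreover, if $e,f$ are tree edges with $e<_{\mathcal{T}} f$ and $g$ is a back edge connecting $\mathcal{T}_f$ with $\mathcal{T}_e\setminus\mathcal{T}_f$ such that $\{e,f,g\}$ is a $3$-edge-cut, then $e<_{\mathcal{T}} f\le_{\mathcal{T}}\mathrm{DeepestDnCut}(e)$.
   Context: $G$ is $3$-edge-connected if connected and remains connected after removing any at most $2$ edges; a $3$-edge-cut is a set of $3$ edges whose removal disconnects $G$. A DFS tree $\mathcal{T}$ rooted at $r$ consists of the edges traversed by a depth-first search; other edges are back edges, each joining an ancestor–descendant pair. Tree edges are directed away from $r$, back edges toward $r$; tail = origin, head = destination. $x\le_{\mathcal{T}}y$ (for vertices/tree edges) if the tree path from $r$ to $y$ contains $x$. For a tree edge $e$, $\mathcal{T}_e$ is the subtree rooted at the deeper endpoint (head) of $e$. A back edge $pq$ leaps over $e$ if $p\in\mathcal{T}_e$ and $q\notin\mathcal{T}_e$. -}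

module Defs where

open import Data.Nat using (ℕ; zero; suc; _≤_; _<_)
open import Data.Fin using (Fin)
open import Data.Product using (Σ; _×_; _,_; proj₁; proj₂)
open import Data.Sum using (_⊎_)
open import Data.List using (List; []; _∷_; length)
open import Data.List.Membership.Propositional using (_∈_; _∉_)
open import Relation.Binary.PropositionalEquality using (_≡_; _≢_)
open import Relation.Nullary using (¬_)

-- A finite multigraph: n vertices, m edges (parallel edges and loops allowed);
-- edge k joins the endpoints  ends k  (unordered: the order in the pair is irrelevant).
record Multigraph : Set where
  field
    n    : ℕ
    m    : ℕ
    ends : Fin m → Fin n × Fin n
open Multigraph public

Joins : (G : Multigraph) → Fin (m G) → Fin (n G) → Fin (n G) → Set
Joins G k a b = (ends G k ≡ (a , b)) ⊎ (ends G k ≡ (b , a))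

data Reach (G : Multigraph) (R : List (Fin (m G))) : Fin (n G) → Fin (n G) → Set where
  here : ∀ {u} → Reach G R u u
  step : ∀ {u w v} (k : Fin (m G)) → k ∉ R → Joins G k u w → Reach G R w v → Reach G R u v

ConnectedWithout : (G : Multigraph) → List (Fin (m G)) → Set
ConnectedWithout G R = ∀ u v → Reach G R u v

Connected : Multigraph → Set
Connected G = ConnectedWithout G []

ThreeEdgeConnected : Multigraph → Set
ThreeEdgeConnected G =
  Connected G × (∀ (R : List (Fin (m G))) → length R ≤ 2 → ConnectedWithout G R)

-- A DFS tree of G, given as a rooted spanning tree: every non-root vertex v has
-- a parent and a tree edge  pedge v  joining parent v to v (directed parent → v),
-- depths decrease along parents (so following parents reaches the root), and
-- every non-tree edge (back edge) joins an ancestor–descendant pair.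
-- (The values of parent/pedge at the root are irrelevant junk.)
record RootedTree (G : Multigraph) : Set where
  field
    root   : Fin (n G)
    parent : Fin (n G) → Fin (n G)
    pedge  : Fin (n G) → Fin (m G)
    depth  : Fin (n G) → ℕ
    depth-root   : depth root ≡ 0
    depth-parent : ∀ v → v ≢ root → depth v ≡ suc (depth (parent v))
    pedge-joins  : ∀ v → v ≢ root → Joins G (pedge v) (parent v) v

module TreeNotions {G : Multigraph} (T : RootedTree G) where
  open RootedTree T public

  -- Anc u v :  u ≤_T v  (u lies on the tree path from the root to v)
  data Anc (u : Fin (n G)) : Fin (n G) → Set where
    here : Anc u u
    up   : ∀ {v} → v ≢ root → Anc u (parent v) → Anc u v

  IsTreeEdge : Fin (m G) → Set
  IsTreeEdge k = Σ (Fin (n G)) λ v → (v ≢ root) × (pedge v ≡ k)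

  NonTreeEdgesAncDesc : Set
  NonTreeEdgesAncDesc = ∀ k → ¬ IsTreeEdge k →
    Anc (proj₁ (ends G k)) (proj₂ (ends G k)) ⊎ Anc (proj₂ (ends G k)) (proj₁ (ends G k))

  -- k is a back edge with tail p and head q (directed toward the root: q ≤_T p)
  BackEdge : Fin (m G) → Fin (n G) → Fin (n G) → Set
  BackEdge k p q = ¬ IsTreeEdge k × Joins G k p q × Anc q p

  -- Tree edges are represented by their head (the deeper endpoint) v ≠ root;
  -- the edge itself is  pedge v , and  T_e  is the set of w with  Anc v w.
  InSub : Fin (n G) → Fin (n G) → Set
  InSub v w = Anc v w

  Leaps : Fin (m G) → Fin (n G) → Fin (n G) → Fin (n G) → Set
  Leaps k p q v = BackEdge k p q × InSub v p × ¬ InSub v q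

  DnCutCand : Fin (n G) → Fin (n G) → Set
  DnCutCand ve vf =
    (vf ≢ root) × Anc ve vf ×
    (∀ k p q → Leaps k p q ve → InSub vf p)

  IsDeepestDnCut : Fin (n G) → Fin (n G) → Set
  IsDeepestDnCut ve d =
    DnCutCand ve d × (∀ f → DnCutCand ve f → f ≢ d → depth f < depth d)

-- A DFS tree of G: a rooted spanning tree all of whose non-tree edges join
-- ancestor–descendant pairs (for connected finite graphs these are exactly the
-- trees produced by depth-first search).
record DFSTree (G : Multigraph) : Set where
  field
    tree     : RootedTree G
    back-anc : TreeNotions.NonTreeEdgesAncDesc tree

{-# OPTIONS --safe #-}
-- Some back edge leaps over e (otherwise e would be a bridge), and every candidate for
-- DeepestDnCut(e) is an ancestor of its tail; so the candidates form a chain and the deepest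
-- one is unique. If {e, f, g} is a cut, f is a candidate: were the tail of some back edge
-- leaping over e outside T_f, then after deleting e, f, g every vertex would still reach the
-- root -- vertices outside T_e along the tree, those in T_e ∖ T_f through that back edge, and
-- those in T_f through a back edge leaping over f other than g, which exists by
-- 3-edge-connectivity.
module Submission where

open import Defs
open import Function using (_∘_)
open import Data.Fin using (Fin; zero; suc; _≟_)
open import Data.Fin.Properties using (any?; all?)
open import Data.Nat using (ℕ; zero; suc; _≤_; _<_; _≤?_; s≤s; z≤n)
open import Data.Nat.Properties
  using (≤-refl; ≤-trans; <⇒≤; ≰⇒>; <⇒≱; <-asym; ≤-<-trans; n<1+n; suc-injective)
open import Data.Product using (Σ; ∃; _×_; _,_; proj₁; proj₂) renaming (swap to swap×)
open import Data.Product.Properties using (,-injective; ≡-dec)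
open import Data.Sum using (_⊎_; inj₁; inj₂; swap)
open import Data.List using (List; _∷_; [])
open import Data.List.Relation.Unary.Any using (here; there)
open import Data.List.Membership.Propositional using (_∈_; _∉_)
open import Relation.Binary.PropositionalEquality using (_≡_; _≢_; refl; sym; trans; subst)
open import Relation.Nullary using (¬_; Dec; yes; no; contradiction)
open import Relation.Nullary.Decidable using (_×-dec_; _⊎-dec_; _→-dec_; ¬?; map′; decidable-stable)
open import Relation.Unary using (Pred; Decidable)

argmax : ∀ {n} {P : Fin n → Set} → Decidable P → (f : Fin n → ℕ) → ∃ P →
         ∃ λ i → P i × (∀ j → P j → f j ≤ f i)
argmax {suc n} P? f w with any? (P? ∘ suc)
... | yes some with argmax (P? ∘ suc) (f ∘ suc) some
...   | i , pi , max with P? zero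
...     | no ¬p0 = suc i , pi , λ { zero p0 → contradiction p0 ¬p0 ; (suc j) pj → max j pj }
...     | yes p0 with f zero ≤? f (suc i)
...       | yes le = suc i , pi , λ { zero _ → le ; (suc j) pj → max j pj }
...       | no gt  = zero , p0 , λ { zero _ → ≤-refl ; (suc j) pj → ≤-trans (max j pj) (<⇒≤ (≰⇒> gt)) }
argmax {suc n} P? f (zero , p)  | no none = zero , p , λ { zero _ → ≤-refl ; (suc j) pj → contradiction (j , pj) none }
argmax {suc n} P? f (suc i , p) | no none = contradiction (i , p) none

module GraphProperties (G : Multigraph) where

  joins-sym : ∀ {k a b} → Joins G k a b → Joins G k b a
  joins-sym = swap

  joins-endpoints : ∀ {k a b c d} → Joins G k a b → Joins G k c d →
                    (c ≡ a × d ≡ b) ⊎ (c ≡ b × d ≡ a)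
  joins-endpoints (inj₁ e) (inj₁ e′) = inj₁ (,-injective (trans (sym e′) e))
  joins-endpoints (inj₁ e) (inj₂ e′) = inj₂ (swap× (,-injective (trans (sym e′) e)))
  joins-endpoints (inj₂ e) (inj₁ e′) = inj₂ (,-injective (trans (sym e′) e))
  joins-endpoints (inj₂ e) (inj₂ e′) = inj₁ (swap× (,-injective (trans (sym e′) e)))

  joins? : ∀ k a b → Dec (Joins G k a b)
  joins? k a b = ≡-dec _≟_ _≟_ (ends G k) (a , b) ⊎-dec ≡-dec _≟_ _≟_ (ends G k) (b , a)

  reach-trans : ∀ {R u v w} → Reach G R u v → Reach G R v w → Reach G R u w
  reach-trans here           q = q
  reach-trans (step k k∉R j p) q = step k k∉R j (reach-trans p q)

  reach-sym : ∀ {R u v} → Reach G R u v → Reach G R v u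
  reach-sym here             = here
  reach-sym (step k k∉R j p) = reach-trans (reach-sym p) (step k k∉R (joins-sym j) here)

  exit-edge : ∀ {R x y} (S : Fin (n G) → Set) → Decidable S → Reach G R x y → S x → ¬ S y →
              ∃ λ k → ∃ λ u → ∃ λ w → k ∉ R × Joins G k u w × S u × ¬ S w
  exit-edge S S? here sx ¬sy = contradiction sx ¬sy
  exit-edge S S? (step {w = w} k k∉R j p) sx ¬sy with S? w
  ... | yes sw = exit-edge S S? p sw ¬sy
  ... | no ¬sw = k , _ , w , k∉R , j , sx , ¬sw

module RootedTreeProperties {G : Multigraph} (T : RootedTree G) where
  open TreeNotions T
  open GraphProperties G

  depth-parent-< : ∀ {v} → v ≢ root → depth (parent v) < depth v
  depth-parent-< {v} v≢r rewrite depth-parent v v≢r = n<1+n _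

  anc-depth-≤ : ∀ {u v} → Anc u v → depth u ≤ depth v
  anc-depth-≤ here         = ≤-refl
  anc-depth-≤ (up v≢r u≤p) = ≤-trans (anc-depth-≤ u≤p) (<⇒≤ (depth-parent-< v≢r))

  anc-depth-< : ∀ {u v} → Anc u v → u ≢ v → depth u < depth v
  anc-depth-< here         u≢v = contradiction refl u≢v
  anc-depth-< (up v≢r u≤p) _   = ≤-<-trans (anc-depth-≤ u≤p) (depth-parent-< v≢r)

  anc-trans : ∀ {x y z} → Anc x y → Anc y z → Anc x z
  anc-trans x≤y here         = x≤y
  anc-trans x≤y (up z≢r y≤p) = up z≢r (anc-trans x≤y y≤p)

  anc-antisym : ∀ {u v} → Anc u v → Anc v u → u ≡ v
  anc-antisym {u} {v} u≤v v≤u with u ≟ v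
  ... | yes u≡v = u≡v
  ... | no u≢v  = contradiction (anc-depth-≤ v≤u) (<⇒≱ (anc-depth-< u≤v u≢v))

  anc-parent : ∀ {u v} → Anc u v → u ≢ v → Anc u (parent v)
  anc-parent here      u≢v = contradiction refl u≢v
  anc-parent (up _ u≤p) _  = u≤p

  anc-comparable : ∀ {a b t} → Anc a t → Anc b t → Anc a b ⊎ Anc b a
  anc-comparable here         b≤t          = inj₂ b≤t
  anc-comparable (up t≢r a≤p) here         = inj₁ (up t≢r a≤p)
  anc-comparable (up _ a≤p)   (up _ b≤p)   = anc-comparable a≤p b≤p

  ¬anc-root : ∀ {v} → v ≢ root → ¬ Anc v root
  ¬anc-root v≢r here       = v≢r refl
  ¬anc-root _   (up r≢r _) = r≢r refl

  desc-nonroot : ∀ {v w} → v ≢ root → Anc v w → w ≢ root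
  desc-nonroot v≢r v≤w refl = ¬anc-root v≢r v≤w

  parent-induction : ∀ {p} (P : Pred (Fin (n G)) p) → P root →
                     (∀ v → v ≢ root → P (parent v) → P v) → ∀ v → P v
  parent-induction P base ind v = go (depth v) v refl
    where
    go : ∀ d v → depth v ≡ d → P v
    go d v dv with v ≟ root | d
    ... | yes refl | _     = base
    ... | no v≢r   | zero  = contradiction (trans (sym dv) (depth-parent v v≢r)) λ ()
    ... | no v≢r   | suc d = ind v v≢r (go d (parent v) (suc-injective (trans (sym (depth-parent v v≢r)) dv)))

  root-anc : ∀ v → Anc root v
  root-anc = parent-induction (Anc root) here (λ _ → up)

  anc? : ∀ u v → Dec (Anc u v)
  anc? u = parent-induction (Dec ∘ Anc u) base ind
    where
    base : Dec (Anc u root)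
    base with u ≟ root
    ... | yes refl = yes here
    ... | no u≢r   = no (¬anc-root u≢r)
    ind : ∀ v → v ≢ root → Dec (Anc u (parent v)) → Dec (Anc u v)
    ind v v≢r u≤p? with u ≟ v
    ... | yes refl = yes here
    ... | no u≢v   = map′ (up v≢r) (λ u≤v → anc-parent u≤v u≢v) u≤p?

  path-to-ancestor : ∀ {R x w} → Anc x w → (∀ y → Anc x y → x ≢ y → Anc y w → pedge y ∉ R) →
                     Reach G R w x
  path-to-ancestor here _ = here
  path-to-ancestor {x = x} {w} (up w≢r x≤p) avoids =
    step (pedge w) (avoids w (up w≢r x≤p) x≢w here) (joins-sym (pedge-joins w w≢r))
      (path-to-ancestor x≤p (λ y x≤y x≢y y≤p → avoids y x≤y x≢y (up w≢r y≤p)))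
    where
    x≢w : x ≢ w
    x≢w refl = contradiction (anc-depth-≤ x≤p) (<⇒≱ (depth-parent-< w≢r))

  pedge-injective : ∀ {y z} → y ≢ root → z ≢ root → pedge y ≡ pedge z → y ≡ z
  pedge-injective {y} {z} y≢r z≢r e
    with joins-endpoints (pedge-joins y y≢r) (subst (λ k → Joins G k (parent z) z) (sym e) (pedge-joins z z≢r))
  ... | inj₁ (_ , z≡y)     = sym z≡y
  ... | inj₂ (pz≡y , z≡py) = contradiction
          (subst (λ t → depth t < depth y) (sym z≡py) (depth-parent-< y≢r))
          (<-asym (subst (λ t → depth t < depth z) pz≡y (depth-parent-< z≢r)))

module DFSTreeProperties {G : Multigraph} (T : DFSTree G) where
  open TreeNotions (DFSTree.tree T)
  open GraphProperties G
  open RootedTreeProperties (DFSTree.tree T)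

  isTreeEdge? : ∀ k → Dec (IsTreeEdge k)
  isTreeEdge? k = any? λ v → ¬? (v ≟ root) ×-dec (pedge v ≟ k)

  leaps? : ∀ k p q v → Dec (Leaps k p q v)
  leaps? k p q v = (¬? (isTreeEdge? k) ×-dec joins? k p q ×-dec anc? q p) ×-dec anc? v p ×-dec ¬? (anc? v q)

  dnCutCand? : ∀ ve vf → Dec (DnCutCand ve vf)
  dnCutCand? ve vf = ¬? (vf ≟ root) ×-dec anc? ve vf ×-dec
    all? (λ k → all? (λ p → all? (λ q → leaps? k p q ve →-dec anc? vf p)))

  non-tree-anc-desc : ∀ {k u w} → ¬ IsTreeEdge k → Joins G k u w → Anc u w ⊎ Anc w u
  non-tree-anc-desc {k} k-back j with ends G k | DFSTree.back-anc T k k-back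
  non-tree-anc-desc k-back (inj₁ refl) | _ | comparable = comparable
  non-tree-anc-desc k-back (inj₂ refl) | _ | comparable = swap comparable

  boundary-edge-leaps : ∀ {v k u w} → v ≢ root → k ≢ pedge v → Joins G k u w →
                        Anc v u → ¬ Anc v w → Leaps k u w v
  boundary-edge-leaps {v} {k} {u} {w} v≢r k≢e j v≤u v≰w = (k-back , j , w≤u) , v≤u , v≰w
    where
    k-back : ¬ IsTreeEdge k
    k-back (z , z≢r , refl) with joins-endpoints (pedge-joins z z≢r) j
    ... | inj₁ (u≡pz , w≡z) = v≰w (subst (Anc v) (sym w≡z) (up z≢r (subst (Anc v) u≡pz v≤u)))
    ... | inj₂ (u≡z , w≡pz) = v≰w (subst (Anc v) (sym w≡pz) (anc-parent (subst (Anc v) u≡z v≤u) v≢z))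
      where
      v≢z : v ≢ z
      v≢z refl = k≢e refl
    w≤u : Anc w u
    w≤u with non-tree-anc-desc k-back j
    ... | inj₁ u≤w = contradiction (anc-trans v≤u u≤w) v≰w
    ... | inj₂ w≤u = w≤u

  record Leap (R : List (Fin (m G))) (v : Fin (n G)) : Set where
    constructor leap
    field
      edge       : Fin (m G)
      tail head  : Fin (n G)
      edge∉R     : edge ∉ R
      leaps-over : Leaps edge tail head v

  leap-avoiding : ∀ {R v} → v ≢ root → pedge v ∈ R → ConnectedWithout G R → Leap R v
  leap-avoiding {R} {v} v≢r e∈R connected
    with exit-edge (Anc v) (anc? v) (connected v root) here (¬anc-root v≢r)
  ... | k , u , w , k∉R , j , v≤u , v≰w =
    leap k u w k∉R (boundary-edge-leaps v≢r (λ k≡e → k∉R (subst (_∈ R) (sym k≡e) e∈R)) j v≤u v≰w)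

  dnCutCand-refl : ∀ {ve} → ve ≢ root → DnCutCand ve ve
  dnCutCand-refl ve≢r = ve≢r , here , λ _ _ _ (_ , ve≤p , _) → ve≤p

  module DeepestDnCut {R ve} (ve≢r : ve ≢ root) (l : Leap R ve) where
    open Leap l

    private
      maximum : ∃ λ d → DnCutCand ve d × (∀ vf → DnCutCand ve vf → depth vf ≤ depth d)
      maximum = argmax (dnCutCand? ve) depth (ve , dnCutCand-refl ve≢r)

    deepest : Fin (n G)
    deepest = proj₁ maximum

    deepest-cand : DnCutCand ve deepest
    deepest-cand = proj₁ (proj₂ maximum)

    cand-anc-deepest : ∀ vf → DnCutCand ve vf → Anc vf deepest
    cand-anc-deepest vf vf-cand@(_ , _ , vf≤tails)
      with anc-comparable (vf≤tails edge tail head leaps-over) (proj₂ (proj₂ deepest-cand) edge tail head leaps-over)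
    ... | inj₁ vf≤d = vf≤d
    ... | inj₂ d≤vf with deepest ≟ vf
    ...   | yes refl = here
    ...   | no d≢vf  = contradiction (proj₂ (proj₂ maximum) vf vf-cand) (<⇒≱ (anc-depth-< d≤vf d≢vf))

    isDeepestDnCut : IsDeepestDnCut ve deepest
    isDeepestDnCut = deepest-cand , λ vf vf-cand vf≢d → anc-depth-< (cand-anc-deepest vf vf-cand) vf≢d

  module CutComplementConnected
    {ve vf : Fin (n G)} (ve≢r : ve ≢ root) (vf≢r : vf ≢ root) (ve≤vf : Anc ve vf) (ve≢vf : ve ≢ vf)
    {g : Fin (m G)} {a b : Fin (n G)} (g-back : ¬ IsTreeEdge g) (g-joins : Joins G g a b) (vf≤a : Anc vf a)
    {k : Fin (m G)} {p q : Fin (n G)} (k-back : ¬ IsTreeEdge k) (k-joins : Joins G k p q)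
    (ve≤p : Anc ve p) (ve≰q : ¬ Anc ve q) (vf≰p : ¬ Anc vf p)
    (f-leap : Leap (pedge vf ∷ g ∷ []) vf)
    where

    R : List (Fin (m G))
    R = pedge ve ∷ pedge vf ∷ g ∷ []

    tree-edge∉R : ∀ {y} → y ≢ root → y ≢ ve → y ≢ vf → pedge y ∉ R
    tree-edge∉R y≢r y≢ve _ (here e)                 = y≢ve (pedge-injective y≢r ve≢r e)
    tree-edge∉R y≢r _ y≢vf (there (here e))         = y≢vf (pedge-injective y≢r vf≢r e)
    tree-edge∉R {y} y≢r _ _ (there (there (here e))) = g-back (y , y≢r , e)
    tree-edge∉R _ _ _ (there (there (there ())))

    back-edge∉R : ∀ {h} → ¬ IsTreeEdge h → h ≢ g → h ∉ R
    back-edge∉R h-back _ (here e)                 = h-back (ve , ve≢r , sym e)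
    back-edge∉R h-back _ (there (here e))         = h-back (vf , vf≢r , sym e)
    back-edge∉R _ h≢g (there (there (here e)))    = h≢g e
    back-edge∉R _ _ (there (there (there ())))

    outside-e→root : ∀ {w} → ¬ Anc ve w → Reach G R w root
    outside-e→root {w} ve≰w = path-to-ancestor (root-anc w) λ y _ r≢y y≤w →
      tree-edge∉R (r≢y ∘ sym) (λ { refl → ve≰w y≤w }) (λ { refl → ve≰w (anc-trans ve≤vf y≤w) })

    between→ve : ∀ {w} → Anc ve w → ¬ Anc vf w → Reach G R w ve
    between→ve ve≤w vf≰w = path-to-ancestor ve≤w λ y ve≤y ve≢y y≤w →
      tree-edge∉R (desc-nonroot ve≢r ve≤y) (ve≢y ∘ sym) (λ { refl → vf≰w y≤w })

    inside-f→vf : ∀ {w} → Anc vf w → Reach G R w vf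
    inside-f→vf vf≤w = path-to-ancestor vf≤w λ y vf≤y vf≢y _ →
      tree-edge∉R (desc-nonroot vf≢r vf≤y) (λ { refl → ve≢vf (anc-antisym ve≤vf vf≤y) }) (vf≢y ∘ sym)

    k≢g : k ≢ g
    k≢g refl with joins-endpoints k-joins g-joins
    ... | inj₁ (a≡p , _) = vf≰p (subst (Anc vf) a≡p vf≤a)
    ... | inj₂ (a≡q , _) = ve≰q (subst (Anc ve) a≡q (anc-trans ve≤vf vf≤a))

    ve→root : Reach G R ve root
    ve→root = reach-trans (reach-sym (between→ve ve≤p vf≰p))
      (step k (back-edge∉R k-back k≢g) k-joins (outside-e→root ve≰q))

    outside-f→root : ∀ {w} → ¬ Anc vf w → Reach G R w root
    outside-f→root {w} vf≰w with anc? ve w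
    ... | yes ve≤w = reach-trans (between→ve ve≤w vf≰w) ve→root
    ... | no ve≰w  = outside-e→root ve≰w

    vf→root : Reach G R vf root
    vf→root = via (Leap.edge∉R f-leap) (Leap.leaps-over f-leap)
      where
      via : ∀ {h p′ q′} → h ∉ pedge vf ∷ g ∷ [] → Leaps h p′ q′ vf → Reach G R vf root
      via {h} h∉ ((h-back , h-joins , _) , vf≤p′ , vf≰q′) =
        reach-trans (reach-sym (inside-f→vf vf≤p′))
          (step h (back-edge∉R h-back (h∉ ∘ there ∘ here)) h-joins (outside-f→root vf≰q′))

    →root : ∀ w → Reach G R w root
    →root w with anc? vf w
    ... | yes vf≤w = reach-trans (inside-f→vf vf≤w) vf→root
    ... | no vf≰w  = outside-f→root vf≰w

    connected : ConnectedWithout G R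
    connected u v = reach-trans (→root u) (reach-sym (→root v))

  dnCutCand-of-cut : ∀ {ve vf g a b} → ThreeEdgeConnected G →
    ve ≢ root → vf ≢ root → Anc ve vf → ve ≢ vf → ¬ IsTreeEdge g → Joins G g a b → Anc vf a →
    ¬ ConnectedWithout G (pedge ve ∷ pedge vf ∷ g ∷ []) → DnCutCand ve vf
  dnCutCand-of-cut {ve} {vf} {g} (_ , 2-removable) ve≢r vf≢r ve≤vf ve≢vf g-back g-joins vf≤a cut =
    vf≢r , ve≤vf , tail-in-f
    where
    f-leap : Leap (pedge vf ∷ g ∷ []) vf
    f-leap = leap-avoiding vf≢r (here refl) (2-removable _ (s≤s (s≤s z≤n)))
    tail-in-f : ∀ k p q → Leaps k p q ve → Anc vf p
    tail-in-f k p q ((k-back , k-joins , _) , ve≤p , ve≰q) = decidable-stable (anc? vf p) λ vf≰p →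
      cut (CutComplementConnected.connected ve≢r vf≢r ve≤vf ve≢vf g-back g-joins vf≤a
             k-back k-joins ve≤p ve≰q vf≰p f-leap)

lemma5p2 : (G : Multigraph) → ThreeEdgeConnected G → (T : DFSTree G) →
    let open TreeNotions (DFSTree.tree T) in
    ∀ (ve : Fin (n G)) → ve ≢ root →
    Σ (Fin (n G)) λ d → IsDeepestDnCut ve d ×
      (∀ (vf : Fin (n G)) → vf ≢ root → Anc ve vf → ve ≢ vf →
       ∀ (g : Fin (m G)) (a b : Fin (n G)) → ¬ IsTreeEdge g → Joins G g a b →
       InSub vf a → InSub ve b → ¬ InSub vf b →
       ¬ ConnectedWithout G (pedge ve ∷ pedge vf ∷ g ∷ []) →
       (Anc ve vf × ve ≢ vf) × Anc vf d)
lemma5p2 G tec T ve ve≢r =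
  deepest , isDeepestDnCut ,
  λ vf vf≢r ve≤vf ve≢vf g a b g-back g-joins vf≤a _ _ cut →
    (ve≤vf , ve≢vf) ,
    cand-anc-deepest vf (dnCutCand-of-cut tec ve≢r vf≢r ve≤vf ve≢vf g-back g-joins vf≤a cut)
  where
  open TreeNotions (DFSTree.tree T)
  open DFSTreeProperties T
  open DeepestDnCut ve≢r (leap-avoiding ve≢r (here refl) (proj₂ tec (pedge ve ∷ []) (s≤s z≤n)))
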